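{- Suppose an adversary presents a bipartite graph $G$ with no induced path on $9$ vertices to the algorithm described in the context. Let $v\in V(G)$ have color index $k$ and let $i$ be an integer with $k\ge 2i\ge 2$. If $S_i(v)$ is complete, then $S_i(v)$ contains an induced copy of $X_i$ in $G$ whose root is $v$.
   Context: The algorithm uses three pairwise disjoint palettes of colors $\{a_n\}_{n\ge1}$, $\{b_n\}_{n\ge1}$, $\{c_n\}_{n\ge1}$. A vertex has color index $i$ if its color is $a_i$ or $b_i$. For a connected bipartite subgraph $C$, its sides are its two color classes; a color is mixed in $C$ if it is used on vertices of both sides of $C$. A vertex $u$ is universal to a subgraph $C$ if $u$ is adjacent to all vertices of one of the sides of $C$. When a vertex $v$ is presented, let $G_i[v]$ be the subgraph induced by $v$ together with all previously presented vertices colored with a color from $\{a_1,\dots,a_i,b_1,\dots,b_i,c_1,\dots,c_i\}$, let $C_i[v]$ be the connected component of $G_i[v]$ containing $v$, put $C_0[v]=\{v\}$, and let $C_i(v)$ be $C_i[v]$ with $v$ removed; for $w\in C_i(v)$, $C^w_i(v)$ is the component of $C_i(v)$ containing $w$ and $C^w_i[v]$ is $C^w_i(v)$ together with $v$ (all at the moment $v$ was presented). The algorithm colors the new vertex $v$ as follows: let $m=\max\{i\ge1: a_i \text{ is mixed in } C_i[v]\}+1$ (with $\max\emptyset=0$); let $I_1,I_2$ be the sides of $C_m[v]$ with $v\in I_1$. If $a_m$ is used on a vertex of $I_2$, color $v$ with $b_m$; else if $c_m$ is used on a vertex of $I_2$, color $v$ with $a_m$; else if there exist $u\in I_1\cup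 I_2$ and $u'\in I_2$ such that $u$ has color index $j\ge m-\sqrt{2m}+2$ and $u'$ is universal to $C_{j-1}[u]$, color $v$ with $c_m$; otherwise color $v$ with $a_m$. Children: for a vertex $v$ of color index $k\ge2$, its children $v_1,v_2$ are the earliest presented vertices on opposite sides of $C_{k-1}(v)$ colored $a_{k-1}$. Grandchildren: for $v$ of color index $k\ge3$ with children $v_1,v_2$, at least one of $C^{v_1}_{k-1}[v]$, $C^{v_2}_{k-1}[v]$ contains no induced path on $5$ vertices with endpoint $v$ (since $G$ has no induced path on 9 vertices); choose (arbitrarily, once and for all) such a $v_\ell$; the children of $v_\ell$ are the grandchildren of $v$. Write $v\to_i w$ if there is a sequence $v=x_1,\dots,x_j=w$ with $j\le i$ and $x_{\ell+1}$ a grandchild of $x_\ell$ for all $\ell<j$; let $S_i(v)=\{w: v\to_i w\}$. $S_i(v)$ is complete if every $u,w\in S_i(v)$ with $u\to_i w$ lying on opposite sides of $G$ (i.e. of their common component) are adjacent. The rooted graphs $X_k$: $X_1$ is a single vertex (the root); $X_2$ is an edge with one endpoint as root; for $k\ge3$, $X_k$ consists of two disjoint copies $X^1_{k-1},X^2_{k-1}$ of $X_{k-1}$ with no edges between them plus a new root vertex adjacent exactly to all vertices of the root side of $X^1_{k-1}$ and all vertices of the non-root side of $X^2_{k-1}$ (root side = side containing the root). -}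

module Defs where

open import Data.Nat using (ℕ; zero; suc; _+_; _*_; _∸_; _≤_; _<_; pred)
open import Data.Fin using (Fin; toℕ) renaming (zero to fzero)
open import Data.Bool using (Bool; true; false; not)
open import Data.Product using (Σ; ∃; ∃₂; _×_; _,_; proj₂)
open import Data.Sum using (_⊎_)
open import Relation.Binary.PropositionalEquality using (_≡_; _≢_)
open import Relation.Nullary using (¬_)

-- Colors: three disjoint palettes a_n, b_n, c_n  (color = palette , n)

data Pal : Set where
  a b c : Pal

Color : Set
Color = Pal × ℕ

-- Finite simple graphs on Fin n; the presentation order is the order of Fin n
-- (vertex x is presented before vertex y iff toℕ x < toℕ y).

record Graph (n : ℕ) : Set where
  field
    E        : Fin n → Fin n → Bool
    E-sym    : ∀ x y → E x y ≡ E y x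
    E-irrefl : ∀ x → E x x ≡ false

open Graph public

Adj : ∀ {n} → Graph n → Fin n → Fin n → Set
Adj G x y = E G x y ≡ true

IsBipartition : ∀ {n} → Graph n → (Fin n → Bool) → Set
IsBipartition G side = ∀ x y → Adj G x y → side x ≢ side y

Consec : ∀ {ℓ} → Fin ℓ → Fin ℓ → Set
Consec i j = toℕ j ≡ suc (toℕ i) ⊎ toℕ i ≡ suc (toℕ j)

InducedPath : ∀ {n ℓ} → Graph n → (Fin ℓ → Fin n) → Set
InducedPath G p =
  (∀ i j → p i ≡ p j → i ≡ j) ×
  (∀ i j → Adj G (p i) (p j) → Consec i j) ×
  (∀ i j → Consec i j → Adj G (p i) (p j))

P9Free : ∀ {n} → Graph n → Set
P9Free {n} G = (p : Fin 9 → Fin n) → ¬ InducedPath G p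

-- The rooted graphs X_k (only k ≥ 1 is meaningful; X_0 is junk = one vertex)
-- rt is the root; leaf is the non-root vertex of X_2;
-- left / right embed the two copies X^1_{k-1}, X^2_{k-1} into X_k (k ≥ 3).

data XV : ℕ → Set where
  rt    : ∀ {k} → XV k
  leaf  : XV 2
  left  : ∀ {k} → XV (suc (suc k)) → XV (suc (suc (suc k)))
  right : ∀ {k} → XV (suc (suc k)) → XV (suc (suc (suc k)))

rootSide : ∀ {k} → XV k → Bool
rootSide rt        = true
rootSide leaf      = false
rootSide (left x)  = not (rootSide x)
rootSide (right x) = rootSide x

XAdj : ∀ {k} → XV k → XV k → Bool
XAdj rt        rt        = false
XAdj rt        leaf      = true
XAdj leaf      rt        = true
XAdj leaf      leaf      = false
XAdj rt        (left y)  = rootSide y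
XAdj rt        (right y) = not (rootSide y)
XAdj (left x)  rt        = rootSide x
XAdj (right x) rt        = not (rootSide x)
XAdj (left x)  (left y)  = XAdj x y
XAdj (right x) (right y) = XAdj x y
XAdj (left x)  (right y) = false
XAdj (right x) (left y)  = false

-- The algorithm and the derived notions, relative to a graph G, a fixed
-- bipartition `side` of G, and the colouring `col` produced.

module Alg {n : ℕ} (G : Graph n) (side : Fin n → Bool) (col : Fin n → Color) where

  Before : Fin n → Fin n → Set
  Before x v = toℕ x < toℕ v

  data Reach (P : Fin n → Set) : Fin n → Fin n → Set where
    here : ∀ {x} → P x → Reach P x x
    step : ∀ {x y z} → P x → Adj G x y → Reach P y z → Reach P x z

  InG : ℕ → Fin n → Fin n → Set
  InG i v x = x ≡ v ⊎ (Before x v × proj₂ (col x) ≤ i)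

  InC : ℕ → Fin n → Fin n → Set
  InC zero    v x = x ≡ v
  InC (suc i) v x = Reach (InG (suc i) v) v x

  InCw : ℕ → Fin n → Fin n → Fin n → Set
  InCw i v w x = Reach (λ y → Before y v × proj₂ (col y) ≤ i) w x

  InCwv : ℕ → Fin n → Fin n → Fin n → Set
  InCwv i v w x = x ≡ v ⊎ InCw i v w x

  HasIndex : Fin n → ℕ → Set
  HasIndex x j = col x ≡ (a , j) ⊎ col x ≡ (b , j)

  -- a_i is mixed in C_i[v] (v itself is not yet coloured when presented)
  MixedA : ℕ → Fin n → Set
  MixedA i v = ∃₂ λ x y → InC i v x × InC i v y × Before x v × Before y v ×
               col x ≡ (a , i) × col y ≡ (a , i) × side x ≢ side y

  -- m = max{ i ≥ 1 : a_i mixed in C_i[v] } + 1   (max ∅ = 0)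
  IsM : Fin n → ℕ → Set
  IsM v m = 1 ≤ m × (∀ i → 1 ≤ i → MixedA i v → i < m) × (m ≡ 1 ⊎ MixedA (pred m) v)

  InI2 : ℕ → Fin n → Fin n → Set
  InI2 m v x = InC m v x × side x ≢ side v

  UsedI2 : Pal → ℕ → Fin n → Set
  UsedI2 p m v = ∃ λ x → InI2 m v x × col x ≡ (p , m)

  Universal : Fin n → ℕ → Fin n → Set
  Universal u' i u = ∃ λ s → ∀ x → InC i u x → side x ≡ s → Adj G u' x

  -- third condition; j ≥ m - √(2m) + 2  ⇔  (m + 2 ∸ j)² ≤ 2m  for naturals
  Cond3 : ℕ → Fin n → Set
  Cond3 m v = ∃₂ λ u u' → ∃ λ j →
    InC m v u × Before u v × InI2 m v u' × HasIndex u j ×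
    (m + 2 ∸ j) * (m + 2 ∸ j) ≤ 2 * m × Universal u' (j ∸ 1) u

  Rule : ℕ → Fin n → Color → Set
  Rule m v κ =
    (UsedI2 a m v × κ ≡ (b , m)) ⊎
    (¬ UsedI2 a m v × UsedI2 c m v × κ ≡ (a , m)) ⊎
    (¬ UsedI2 a m v × ¬ UsedI2 c m v × Cond3 m v × κ ≡ (c , m)) ⊎
    (¬ UsedI2 a m v × ¬ UsedI2 c m v × ¬ Cond3 m v × κ ≡ (a , m))

  AlgorithmColoring : Set
  AlgorithmColoring = ∀ v → ∃ λ m → IsM v m × Rule m v (col v)

  IsChildAt : ℕ → Fin n → Fin n → Set
  IsChildAt k v w =
    InC (k ∸ 1) v w × Before w v × col w ≡ (a , k ∸ 1) ×
    (∀ x → InC (k ∸ 1) v x → Before x v → col x ≡ (a , k ∸ 1) →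
           side x ≡ side w → toℕ w ≤ toℕ x)

  ChildOf : Fin n → Fin n → Set
  ChildOf v w = ∃ λ k → HasIndex v k × 2 ≤ k × IsChildAt k v w

  NoP5End : ℕ → Fin n → Fin n → Set
  NoP5End i v w = (p : Fin 5 → Fin n) → InducedPath G p → p fzero ≡ v →
                  ¬ (∀ t → InCwv i v w (p t))

  -- ch is an (arbitrary, fixed) admissible choice of the child v_ℓ
  GoodChoice : (Fin n → Fin n) → Set
  GoodChoice ch = ∀ v k → HasIndex v k → 3 ≤ k →
                  IsChildAt k v (ch v) × NoP5End (k ∸ 1) v (ch v)

  module _ (ch : Fin n → Fin n) where

    Grandchild : Fin n → Fin n → Set
    Grandchild v w = ∃ λ k → HasIndex v k × 3 ≤ k × ChildOf (ch v) w

    -- grandchild sequence from v to w with d steps (d + 1 vertices)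
    data GSeq : Fin n → Fin n → ℕ → Set where
      gnil  : ∀ {v} → GSeq v v 0
      gcons : ∀ {v u w d} → Grandchild v u → GSeq u w d → GSeq v w (suc d)

    Arrow : ℕ → Fin n → Fin n → Set
    Arrow i v w = ∃ λ d → suc d ≤ i × GSeq v w d

    Complete : ℕ → Fin n → Set
    Complete i v = ∀ u w → Arrow i v u → Arrow i v w → Arrow i u w →
                   side u ≢ side w → Adj G u w

    InducedCopyX : ℕ → Fin n → Set
    InducedCopyX i v = Σ (XV i → Fin n) λ f →
      (∀ x y → f x ≡ f y → x ≡ y) × f rt ≡ v × (∀ x → Arrow i v (f x)) ×
      (∀ x y → E G (f x) (f y) ≡ XAdj x y)

-- The copy is built by induction on i, keeping track of sides: a vertex x of X_i
-- is mapped to v's side of G exactly when x lies on the root side of X_i.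
-- For i ≥ 2 the step uses two grandchildren p, q of v, both coloured a_{k-2},
-- with p on the other side of v and q on v's side; copies of X_{i-1} rooted at p
-- and at q, together with v, form X_i.  Three facts make this work:
--   * every grandchild sequence from u stays among vertices presented no later
--     than u and of index at most that of u ("below u");
--   * (separation) whatever lies below p is disjoint from and non-adjacent to
--     whatever lies below q, since otherwise the later of p, q would have seen
--     the other one in I₂ and would not have been coloured a_{k-2};
--   * completeness of S_i(v) makes v adjacent to exactly the vertices of S_i(v)
--     on the other side.
-- The grandchildren p, q exist because the chosen child of v is coloured
-- a_{k-1}, so a_{k-2} is mixed in its component; taking the earliest vertex on
-- each side needs decidability of reachability, proved in the module Walks.
-- P9Free is used in the paper only to justify the choice of grandchildren,
-- which the statement provides through GoodChoice.
module Submission where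

open import Defs
open import Data.Nat using (ℕ; zero; suc; _*_; _∸_; _≤_; _<_; z≤n; s≤s)
open import Data.Nat.Properties
  using (≤-refl; ≤-trans; ≤-reflexive; <-trans; <⇒≤; ≤-<-trans; n≤1+n; m≤n⇒m≤1+n;
         m≤n⇒m<n∨m≡n; <-cmp; <⇒≢; ≮⇒≥; *-suc; ≤-pred)
  renaming (_≟_ to _≟ℕ_; _<?_ to _<ℕ?_; _≤?_ to _≤ℕ?_)
open import Data.Fin using (Fin; toℕ; fromℕ<; inject)
open import Data.Fin.Properties
  using (toℕ-injective; toℕ-inject; toℕ-fromℕ<; any?; ¬∀⟶∃¬-smallest)
  renaming (_≟_ to _≟F_)
open import Data.Bool using (Bool; true; false; not; _xor_)
open import Data.Bool.Properties
  using (¬-not; not-involutive; xor-assoc; xor-same; xor-identityʳ; xor-inverseˡ)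
  renaming (_≟_ to _≟B_)
open import Data.Product using (Σ; ∃; _×_; _,_; proj₁; proj₂)
open import Data.Product.Properties using (≡-dec)
open import Data.Sum using (_⊎_; inj₁; inj₂)
import Data.Sum as Sum
open import Data.Empty using (⊥-elim)
open import Data.List using (List; _∷_; length; filter; allFin)
open import Data.List.Properties using (filter-notAll)
import Data.List.Relation.Unary.Any as Any
open import Data.List.Membership.Propositional using (_∈_)
open import Data.List.Membership.Propositional.Properties using (∈-filter⁺; ∈-filter⁻; ∈-allFin)
open import Relation.Nullary using (¬_; Dec; yes; no; ¬?)
open import Relation.Nullary.Decidable using (_×-dec_; _⊎-dec_; map′; decidable-stable)
open import Relation.Binary.Definitions using (tri<; tri≈; tri>)
open import Relation.Binary.PropositionalEquality
  using (_≡_; _≢_; refl; sym; trans; cong; subst; module ≡-Reasoning)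

_≟P_ : (x y : Pal) → Dec (x ≡ y)
a ≟P a = yes refl
b ≟P b = yes refl
c ≟P c = yes refl
a ≟P b = no λ ()
a ≟P c = no λ ()
b ≟P a = no λ ()
b ≟P c = no λ ()
c ≟P a = no λ ()
c ≟P b = no λ ()

_≟C_ : (x y : Color) → Dec (x ≡ y)
_≟C_ = ≡-dec _≟P_ _≟ℕ_

other-side : ∀ {s t u : Bool} → s ≢ t → s ≢ u → t ≡ u
other-side s≢t s≢u = trans (¬-not (λ t≡s → s≢t (sym t≡s))) (sym (¬-not (λ u≡s → s≢u (sym u≡s))))

xor-not-swap : ∀ b s → b xor not s ≡ not b xor s
xor-not-swap true  s = not-involutive s
xor-not-swap false s = refl

XAdj-root : ∀ {i} (x : XV i) → XAdj rt x ≡ not (rootSide x)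
XAdj-root rt        = refl
XAdj-root leaf      = refl
XAdj-root (left x)  = sym (not-involutive (rootSide x))
XAdj-root (right x) = refl

earliest : ∀ {n} {Q : Fin n → Set} → (∀ z → Dec (Q z)) → ∀ {x} → Q x →
           Σ (Fin n) λ z → Q z × (∀ z' → Q z' → toℕ z ≤ toℕ z')
earliest {n} {Q} Q? {x} qx
  with ¬∀⟶∃¬-smallest n (λ z → ¬ Q z) (λ z → ¬? (Q? z)) (λ none → none x qx)
... | z , ¬¬qz , before = z , decidable-stable (Q? z) ¬¬qz , first
  where
    first : ∀ z' → Q z' → toℕ z ≤ toℕ z'
    first z' qz' = ≮⇒≥ λ z'<z → before (fromℕ< z'<z) (subst Q (sym (back z'<z)) qz')
      where
        back : (z'<z : toℕ z' < toℕ z) → inject (fromℕ< z'<z) ≡ z'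
        back z'<z = toℕ-injective (trans (toℕ-inject (fromℕ< z'<z)) (toℕ-fromℕ< z'<z))

-- 2(i+1) ≤ k splits off the two colour indices between v and its grandchildren.
double-suc-≤ : ∀ {i k} → 2 * suc i ≤ k → Σ ℕ λ K → k ≡ suc (suc K) × 2 * i ≤ K
double-suc-≤ {i} {k} h with subst (_≤ k) (*-suc 2 i) h
... | s≤s (s≤s h') = _ , refl , h'

-- Walks inside a vertex set P of G, and their decidability (the walks do not
-- depend on side and col; these only parametrise the module defining Reach).
module Walks {n : ℕ} (G : Graph n) (side : Fin n → Bool) (col : Fin n → Color) where
  open Alg G side col using (Reach; here; step)
  open import Data.List.Membership.DecPropositional (_≟F_ {n}) using (_∈?_)

  adj-sym : ∀ {x y} → Adj G x y → Adj G y x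
  adj-sym {x} {y} e = trans (E-sym G y x) e

  reach-start : ∀ {P x y} → Reach P x y → P x
  reach-start (here px)     = px
  reach-start (step px _ _) = px

  reach-end : ∀ {P x y} → Reach P x y → P y
  reach-end (here py)    = py
  reach-end (step _ _ r) = reach-end r

  reach-mono : ∀ {P Q : Fin n → Set} {x y} → (∀ {z} → P z → Q z) → Reach P x y → Reach Q x y
  reach-mono f (here px)     = here (f px)
  reach-mono f (step px e r) = step (f px) e (reach-mono f r)

  reach-trans : ∀ {P x y z} → Reach P x y → Reach P y z → Reach P x z
  reach-trans (here _)      r' = r'
  reach-trans (step px e r) r' = step px e (reach-trans r r')

  reach-sym : ∀ {P x y} → Reach P x y → Reach P y x
  reach-sym (here px)     = here px
  reach-sym (step px e r) = reach-trans (reach-sym r) (step (reach-start r) (adj-sym e) (here px))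

  _∖_ : List (Fin n) → Fin n → List (Fin n)
  L ∖ x = filter (λ z → ¬? (z ≟F x)) L

  ∖-⊆ : ∀ {L x z} → z ∈ L ∖ x → z ∈ L
  ∖-⊆ {L} {x} m = proj₁ (∈-filter⁻ (λ z → ¬? (z ≟F x)) {xs = L} m)

  ∉-∖ : ∀ {L x} → ¬ (x ∈ L ∖ x)
  ∉-∖ {L} {x} m = proj₂ (∈-filter⁻ (λ z → ¬? (z ≟F x)) {xs = L} m) refl

  last-exit : ∀ {L x z y} → Reach (_∈ L) z y →
              Reach (_∈ L ∖ x) z y ⊎ x ≡ y ⊎ (∃ λ z' → Adj G x z' × Reach (_∈ L ∖ x) z' y)
  last-exit {x = x} (here {z} z∈L) with z ≟F x
  ... | yes z≡x = inj₂ (inj₁ (sym z≡x))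
  ... | no  z≢x = inj₁ (here (∈-filter⁺ (λ z → ¬? (z ≟F x)) z∈L z≢x))
  last-exit {x = x} (step {z} {z₁} z∈L e r) with last-exit {x = x} r
  ... | inj₂ later = inj₂ later
  ... | inj₁ r' with z ≟F x
  ...   | yes refl = inj₂ (inj₂ (z₁ , e , r'))
  ...   | no  z≢x  = inj₁ (step (∈-filter⁺ (λ z → ¬? (z ≟F x)) z∈L z≢x) e r')

  -- Reachability inside a list, by recursion on a bound for its length:
  -- x reaches y ≠ x iff some neighbour of x reaches y avoiding x.
  reach-in-list? : ∀ bound L → length L ≤ bound → ∀ x y → Dec (Reach (_∈ L) x y)
  reach-in-list? bound L short x y with x ∈? L | x ≟F y
  ... | no  x∉L | _        = no λ r → x∉L (reach-start r)
  ... | yes x∈L | yes refl = yes (here x∈L)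
  reach-in-list? zero    (_ ∷ _) () x y | yes _   | no _
  reach-in-list? (suc bound) L short x y | yes x∈L | no x≢y =
    map′ (λ (z , e , r) → step x∈L e (reach-mono ∖-⊆ r)) leave
         (any? λ z → (E G x z ≟B true) ×-dec reach-in-list? bound (L ∖ x) shorter z y)
    where
      shorter : length (L ∖ x) ≤ bound
      shorter = ≤-pred (≤-trans (filter-notAll (λ z → ¬? (z ≟F x)) L
                                  (Any.map (λ x≡z z≢x → z≢x (sym x≡z)) x∈L)) short)
      leave : Reach (_∈ L) x y → ∃ λ z → Adj G x z × Reach (_∈ L ∖ x) z y
      leave r with last-exit {x = x} r
      ... | inj₁ avoid       = ⊥-elim (∉-∖ {L} (reach-start avoid))
      ... | inj₂ (inj₁ x≡y)  = ⊥-elim (x≢y x≡y)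
      ... | inj₂ (inj₂ exit) = exit

  reach? : ∀ {P : Fin n → Set} → (∀ z → Dec (P z)) → ∀ x y → Dec (Reach P x y)
  reach? {P} P? x y =
    map′ (reach-mono (λ m → proj₂ (∈-filter⁻ P? {xs = allFin n} m)))
         (reach-mono (λ {z} pz → ∈-filter⁺ P? (∈-allFin z) pz))
         (reach-in-list? _ (filter P? (allFin n)) ≤-refl x y)

module Construction {n : ℕ} (G : Graph n) (side : Fin n → Bool) (bip : IsBipartition G side)
                    (col : Fin n → Color) (alg : Alg.AlgorithmColoring G side col)
                    (ch : Fin n → Fin n) (good : Alg.GoodChoice G side col ch) where
  open Alg G side col
  open Walks G side col

  index : Fin n → ℕ
  index x = proj₂ (col x)

  index-of : ∀ {x k} → HasIndex x k → index x ≡ k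
  index-of (inj₁ e) = cong proj₂ e
  index-of (inj₂ e) = cong proj₂ e

  rule-index : ∀ {m v κ} → Rule m v κ → proj₂ κ ≡ m
  rule-index (inj₁ (_ , refl))                       = refl
  rule-index (inj₂ (inj₁ (_ , _ , refl)))            = refl
  rule-index (inj₂ (inj₂ (inj₁ (_ , _ , _ , refl)))) = refl
  rule-index (inj₂ (inj₂ (inj₂ (_ , _ , _ , refl)))) = refl

  a-colour-unseen : ∀ {m v K} → Rule m v (a , K) → ¬ UsedI2 a K v
  a-colour-unseen (inj₁ (_ , ()))
  a-colour-unseen (inj₂ (inj₁ (unseen , _ , refl)))            = unseen
  a-colour-unseen (inj₂ (inj₂ (inj₁ (_ , _ , _ , ()))))
  a-colour-unseen (inj₂ (inj₂ (inj₂ (unseen , _ , _ , refl)))) = unseen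

  -- A vertex coloured a_{j+2} got index j+2 = m, so a_{j+1} is mixed in C_{j+1}.
  a-colour-mixed-below : ∀ {x j} → col x ≡ (a , suc (suc j)) → MixedA (suc j) x
  a-colour-mixed-below {x} cx with alg x
  ... | m , (_ , _ , one-or-mixed) , rule with trans (sym (cong proj₂ cx)) (rule-index rule)
  ...   | refl with one-or-mixed
  ...     | inj₁ ()
  ...     | inj₂ mixed = mixed

  child-earlier : ∀ {k u w} → IsChildAt k u w → Before w u
  child-earlier child = proj₁ (proj₂ child)

  child-colour : ∀ {k u w} → IsChildAt k u w → col w ≡ (a , k ∸ 1)
  child-colour child = proj₁ (proj₂ (proj₂ child))

  chosen-child : ∀ {v k} → HasIndex v k → 3 ≤ k → IsChildAt k v (ch v)
  chosen-child {v} {k} hv 3≤k = proj₁ (good v k hv 3≤k)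

  Below : Fin n → Fin n → Set
  Below u z = toℕ z ≤ toℕ u × index z ≤ index u

  below-trans : ∀ {u w z} → Below u w → Below w z → Below u z
  below-trans (w≤u , iw≤iu) (z≤w , iz≤iw) = ≤-trans z≤w w≤u , ≤-trans iz≤iw iw≤iu

  reach-below-trans : ∀ {u w z} → Reach (Below u) u w → Reach (Below w) w z → Reach (Below u) u z
  reach-below-trans r r' = reach-trans r (reach-mono (below-trans (reach-end r)) r')

  InG-below : ∀ {m u z} → m ≤ index u → InG m u z → Below u z
  InG-below m≤iu (inj₁ refl)          = ≤-refl , ≤-refl
  InG-below m≤iu (inj₂ (z<u , iz≤m)) = <⇒≤ z<u , ≤-trans iz≤m m≤iu

  child-reach : ∀ {u k w} → HasIndex u (suc (suc k)) → IsChildAt (suc (suc k)) u w →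
                Reach (Below u) u w
  child-reach hu child =
    reach-mono (InG-below (≤-trans (n≤1+n _) (≤-reflexive (sym (index-of hu))))) (proj₁ child)

  grandchild-reach : ∀ {v w} → Grandchild ch v w → Reach (Below v) v w
  grandchild-reach (k , hv , 3≤k@(s≤s (s≤s (s≤s z≤n))) , (_ , hc , s≤s (s≤s z≤n) , child)) =
    reach-below-trans (child-reach hv (chosen-child hv 3≤k)) (child-reach hc child)

  grandchild-earlier : ∀ {v w} → Grandchild ch v w → toℕ w < toℕ v
  grandchild-earlier (k , hv , 3≤k , (k' , _ , _ , child)) =
    <-trans (child-earlier {k'} child) (child-earlier {k} (chosen-child hv 3≤k))

  gseq-reach : ∀ {u w d} → GSeq ch u w d → Reach (Below u) u w
  gseq-reach gnil         = here (≤-refl , ≤-refl)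
  gseq-reach (gcons g gs) = reach-below-trans (grandchild-reach g) (gseq-reach gs)

  arrow-reach : ∀ {i u w} → Arrow ch i u w → Reach (Below u) u w
  arrow-reach (_ , _ , gs) = gseq-reach gs

  through : ∀ {i v g u} → Grandchild ch v g → Arrow ch i g u → Arrow ch (suc i) v u
  through g (d , d<i , gs) = suc d , s≤s d<i , gcons g gs

  arrow-weaken : ∀ {i u w} → Arrow ch i u w → Arrow ch (suc i) u w
  arrow-weaken (d , d<i , gs) = d , m≤n⇒m≤1+n d<i , gs

  S-earlier : ∀ {i v g u} → Grandchild ch v g → Arrow ch i g u → toℕ u < toℕ v
  S-earlier g au = ≤-<-trans (proj₁ (reach-end (arrow-reach au))) (grandchild-earlier g)

  complete-grandchild : ∀ {i v g} → Grandchild ch v g → Complete ch (suc i) v → Complete ch i g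
  complete-grandchild g cv u w au aw auw opposite =
    cv u w (through g au) (through g aw) (arrow-weaken auw) opposite

  Touch : Fin n → Fin n → Set
  Touch x y = x ≡ y ⊎ Adj G x y

  touch-sym : ∀ {x y} → Touch x y → Touch y x
  touch-sym = Sum.map sym adj-sym

  -- If p, q are coloured a_{K+1} on opposite sides and p came first, nothing
  -- below q touches anything below p: such a contact would put p into I₂ of
  -- C_{K+1}[q], and then q would have been coloured b_{K+1}.
  earlier-apart : ∀ {p q x y K} → toℕ p < toℕ q → col p ≡ (a , suc K) → col q ≡ (a , suc K) →
                  side p ≢ side q → Reach (Below p) p x → Reach (Below q) q y → ¬ Touch y x
  earlier-apart {p} {q} {x} {y} {K} p<q cp cq opposite rp rq touch with alg q
  ... | m , _ , rule = a-colour-unseen (subst (Rule m q) cq rule) (p , (q↝p , opposite) , cp)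
    where
      iq : index q ≡ suc K
      iq = cong proj₂ cq
      below-q : ∀ {z} → Below q z → InG (suc K) q z
      below-q (z≤q , iz≤iq) with m≤n⇒m<n∨m≡n z≤q
      ... | inj₁ z<q = inj₂ (z<q , ≤-trans iz≤iq (≤-reflexive iq))
      ... | inj₂ z≡q = inj₁ (toℕ-injective z≡q)
      below-p : ∀ {z} → Below p z → InG (suc K) q z
      below-p (z≤p , iz≤ip) = inj₂ (≤-<-trans z≤p p<q , ≤-trans iz≤ip (≤-reflexive (cong proj₂ cp)))
      cross : Touch y x → Reach (InG (suc K) q) x p → Reach (InG (suc K) q) y p
      cross (inj₁ y≡x) x↝p = subst (λ t → Reach (InG (suc K) q) t p) (sym y≡x) x↝p
      cross (inj₂ y~x) x↝p = step (reach-end (reach-mono below-q rq)) y~x x↝p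
      q↝p : Reach (InG (suc K) q) q p
      q↝p = reach-trans (reach-mono below-q rq) (cross touch (reach-sym (reach-mono below-p rp)))

  separated : ∀ {p q x y K} → col p ≡ (a , suc K) → col q ≡ (a , suc K) → side p ≢ side q →
              Reach (Below p) p x → Reach (Below q) q y → ¬ Touch x y
  separated {p} {q} cp cq opposite rp rq touch with <-cmp (toℕ p) (toℕ q)
  ... | tri< p<q _ _ = earlier-apart p<q cp cq opposite rp rq (touch-sym touch)
  ... | tri≈ _ p≡q _ = opposite (cong side (toℕ-injective p≡q))
  ... | tri> _ _ q<p = earlier-apart q<p cq cp (λ e → opposite (sym e)) rq rp touch

  InG? : ∀ m u z → Dec (InG m u z)
  InG? m u z = (z ≟F u) ⊎-dec ((toℕ z <ℕ? toℕ u) ×-dec (index z ≤ℕ? m))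

  earliest-child : ∀ {u x j} → InC (suc j) u x → Before x u → col x ≡ (a , suc j) →
                   ∃ λ w → IsChildAt (suc (suc j)) u w × side w ≡ side x
  earliest-child {u} {x} {j} x∈C x<u cx with earliest Q? (x∈C , x<u , cx , refl)
    where
      Q : Fin n → Set
      Q z = InC (suc j) u z × Before z u × col z ≡ (a , suc j) × side z ≡ side x
      Q? : ∀ z → Dec (Q z)
      Q? z = reach? (InG? (suc j) u) u z ×-dec ((toℕ z <ℕ? toℕ u) ×-dec
             ((col z ≟C (a , suc j)) ×-dec (side z ≟B side x)))
  ... | w , (w∈C , w<u , cw , sw) , first =
    w , (w∈C , w<u , cw , λ z z∈C z<u cz sz → first z (z∈C , z<u , cz , trans sz sw)) , sw

  child-of-chosen : ∀ {v k w} → HasIndex v (suc (suc (suc k))) →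
                    IsChildAt (suc (suc k)) (ch v) w → Grandchild ch v w
  child-of-chosen {k = k} hv child = _ , hv , 3≤k ,
    (_ , inj₁ (child-colour {suc (suc (suc k))} (chosen-child hv 3≤k)) , s≤s (s≤s z≤n) , child)
    where
      3≤k : 3 ≤ suc (suc (suc k))
      3≤k = s≤s (s≤s (s≤s z≤n))

  record GrandchildPair (v : Fin n) (K : ℕ) : Set where
    field
      p q          : Fin n
      p-grandchild : Grandchild ch v p
      q-grandchild : Grandchild ch v q
      p-colour     : col p ≡ (a , K)
      q-colour     : col q ≡ (a , K)
      p-opposite   : side p ≢ side v
      q-same       : side q ≡ side v

  -- The chosen child of v is coloured a_{K+1}, so a_K is mixed in its
  -- component; the earliest a_K-vertices on both sides are grandchildren of v.
  grandchildren-on-both-sides : ∀ v K → HasIndex v (suc (suc K)) → 2 ≤ K → GrandchildPair v K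
  grandchildren-on-both-sides v K@(suc (suc r)) hv (s≤s (s≤s z≤n))
    with a-colour-mixed-below (child-colour {suc (suc K)} (chosen-child hv 3≤k))
    where
      3≤k : 3 ≤ suc (suc K)
      3≤k = s≤s (s≤s (s≤s z≤n))
  ... | x , y , x∈C , y∈C , x<c , y<c , cx , cy , x≢y
    with earliest-child x∈C x<c cx | earliest-child y∈C y<c cy
  ... | w₁ , child₁ , s₁ | w₂ , child₂ , s₂ with side x ≟B side v
  ...   | yes x~v = record
          { p = w₂ ; q = w₁ ; p-grandchild = child-of-chosen hv child₂ ; q-grandchild = child-of-chosen hv child₁
          ; p-colour = child-colour {suc K} child₂ ; q-colour = child-colour {suc K} child₁
          ; p-opposite = λ e → x≢y (trans x~v (trans (sym e) s₂)) ; q-same = trans s₁ x~v }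
  ...   | no x≁v = record
          { p = w₁ ; q = w₂ ; p-grandchild = child-of-chosen hv child₁ ; q-grandchild = child-of-chosen hv child₂
          ; p-colour = child-colour {suc K} child₁ ; q-colour = child-colour {suc K} child₂
          ; p-opposite = λ e → x≁v (trans (sym s₁) e) ; q-same = trans s₂ (other-side x≢y x≁v) }

  root-adjacency : ∀ {I v u} → 1 ≤ I → Complete ch I v → Arrow ch I v u →
                   E G v u ≡ side u xor side v
  root-adjacency {v = v} {u} 1≤I cv au with side u ≟B side v
  ... | yes same = begin
    E G v u            ≡⟨ ¬-not (λ e → bip v u e (sym same)) ⟩
    false              ≡⟨ sym (xor-same (side v)) ⟩
    side v xor side v  ≡⟨ cong (_xor side v) (sym same) ⟩
    side u xor side v  ∎
    where open ≡-Reasoning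
  ... | no differ = begin
    E G v u                 ≡⟨ cv v u (0 , 1≤I , gnil) au au (λ e → differ (sym e)) ⟩
    true                    ≡⟨ sym (xor-inverseˡ (side v)) ⟩
    not (side v) xor side v ≡⟨ cong (_xor side v) (sym (¬-not differ)) ⟩
    side u xor side v       ∎
    where open ≡-Reasoning

  root-row : ∀ {I i v u} {x : XV i} → 1 ≤ I → Complete ch I v → Arrow ch I v u →
             side u ≡ not (rootSide x) xor side v → E G v u ≡ XAdj rt x
  root-row {v = v} {u} {x} 1≤I cv au su = begin
    E G v u                                  ≡⟨ root-adjacency 1≤I cv au ⟩
    side u xor side v                        ≡⟨ cong (_xor side v) su ⟩
    (not (rootSide x) xor side v) xor side v ≡⟨ xor-assoc (not (rootSide x)) (side v) (side v) ⟩
    not (rootSide x) xor (side v xor side v) ≡⟨ cong (not (rootSide x) xor_) (xor-same (side v)) ⟩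
    not (rootSide x) xor false               ≡⟨ xor-identityʳ (not (rootSide x)) ⟩
    not (rootSide x)                         ≡⟨ sym (XAdj-root x) ⟩
    XAdj rt x                                ∎
    where open ≡-Reasoning

  record RootedCopy (i : ℕ) (v : Fin n) : Set where
    field
      embed     : XV i → Fin n
      injective : ∀ x y → embed x ≡ embed y → x ≡ y
      root      : embed rt ≡ v
      in-S      : ∀ x → Arrow ch i v (embed x)
      induced   : ∀ x y → E G (embed x) (embed y) ≡ XAdj x y
      sides     : ∀ x → side (embed x) ≡ not (rootSide x) xor side v

  single : ∀ v → RootedCopy 1 v
  single v = record
    { embed = λ _ → v ; injective = λ { rt rt _ → refl } ; root = refl
    ; in-S = λ { rt → 0 , s≤s z≤n , gnil } ; induced = λ { rt rt → E-irrefl G v }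
    ; sides = λ { rt → refl } }

  edge : ∀ {v K} → Complete ch 2 v → GrandchildPair v K → RootedCopy 2 v
  edge {v} cv P = record
    { embed = f ; injective = inj ; root = refl ; in-S = arr ; induced = adj ; sides = sok }
    where
      open GrandchildPair P
      f : XV 2 → Fin n
      f rt   = v
      f leaf = p
      p≢v : p ≢ v
      p≢v e = <⇒≢ (grandchild-earlier p-grandchild) (cong toℕ e)
      inj : ∀ x y → f x ≡ f y → x ≡ y
      inj rt   rt   _ = refl
      inj rt   leaf e = ⊥-elim (p≢v (sym e))
      inj leaf rt   e = ⊥-elim (p≢v e)
      inj leaf leaf _ = refl
      arr : ∀ x → Arrow ch 2 v (f x)
      arr rt   = 0 , s≤s z≤n , gnil
      arr leaf = 1 , s≤s (s≤s z≤n) , gcons p-grandchild gnil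
      sok : ∀ x → side (f x) ≡ not (rootSide x) xor side v
      sok rt   = refl
      sok leaf = ¬-not p-opposite
      adj : ∀ x y → E G (f x) (f y) ≡ XAdj x y
      adj rt   y    = root-row {x = y} (s≤s z≤n) cv (arr y) (sok y)
      adj leaf rt   = trans (E-sym G p v) (adj rt leaf)
      adj leaf leaf = E-irrefl G p

  -- X_{i+3} is v together with copies of X_{i+2} rooted at p (other side) and
  -- q (v's side): the copies are apart by separation, and v sees them as
  -- prescribed by completeness.
  glue : ∀ {v K i} → 2 ≤ K → Complete ch (suc (suc (suc i))) v → (P : GrandchildPair v K) →
         RootedCopy (suc (suc i)) (GrandchildPair.p P) → RootedCopy (suc (suc i)) (GrandchildPair.q P) →
         RootedCopy (suc (suc (suc i))) v
  glue {v} {i = i} (s≤s (s≤s z≤n)) cv P C₁ C₂ = record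
    { embed = f ; injective = inj ; root = refl ; in-S = arr ; induced = adj ; sides = sok }
    where
      open GrandchildPair P
      module C₁ = RootedCopy C₁
      module C₂ = RootedCopy C₂
      f : XV (suc (suc (suc i))) → Fin n
      f rt        = v
      f (left x)  = C₁.embed x
      f (right x) = C₂.embed x
      arr : ∀ x → Arrow ch (suc (suc (suc i))) v (f x)
      arr rt        = 0 , s≤s z≤n , gnil
      arr (left x)  = through p-grandchild (C₁.in-S x)
      arr (right x) = through q-grandchild (C₂.in-S x)
      apart : ∀ x y → ¬ Touch (C₁.embed x) (C₂.embed y)
      apart x y = separated p-colour q-colour (λ e → p-opposite (trans e q-same))
                            (arrow-reach (C₁.in-S x)) (arrow-reach (C₂.in-S y))
      not-root₁ : ∀ x → C₁.embed x ≢ v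
      not-root₁ x e = <⇒≢ (S-earlier p-grandchild (C₁.in-S x)) (cong toℕ e)
      not-root₂ : ∀ x → C₂.embed x ≢ v
      not-root₂ x e = <⇒≢ (S-earlier q-grandchild (C₂.in-S x)) (cong toℕ e)
      inj : ∀ x y → f x ≡ f y → x ≡ y
      inj rt        rt        _ = refl
      inj rt        (left y)  e = ⊥-elim (not-root₁ y (sym e))
      inj rt        (right y) e = ⊥-elim (not-root₂ y (sym e))
      inj (left x)  rt        e = ⊥-elim (not-root₁ x e)
      inj (right x) rt        e = ⊥-elim (not-root₂ x e)
      inj (left x)  (left y)  e = cong left (C₁.injective x y e)
      inj (right x) (right y) e = cong right (C₂.injective x y e)
      inj (left x)  (right y) e = ⊥-elim (apart x y (inj₁ e))
      inj (right x) (left y)  e = ⊥-elim (apart y x (inj₁ (sym e)))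
      sok : ∀ x → side (f x) ≡ not (rootSide x) xor side v
      sok rt        = refl
      sok (left x)  = begin
        side (C₁.embed x)                 ≡⟨ C₁.sides x ⟩
        not (rootSide x) xor side p       ≡⟨ cong (not (rootSide x) xor_) (¬-not p-opposite) ⟩
        not (rootSide x) xor not (side v) ≡⟨ xor-not-swap (not (rootSide x)) (side v) ⟩
        not (not (rootSide x)) xor side v ∎
        where open ≡-Reasoning
      sok (right x) = trans (C₂.sides x) (cong (not (rootSide x) xor_) q-same)
      no-edge : ∀ x y → E G (C₁.embed x) (C₂.embed y) ≡ false
      no-edge x y = ¬-not (λ e → apart x y (inj₂ e))
      adj : ∀ x y → E G (f x) (f y) ≡ XAdj x y
      adj rt        y         = root-row {x = y} (s≤s z≤n) cv (arr y) (sok y)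
      adj (left x)  rt        = trans (E-sym G (C₁.embed x) v) (adj rt (left x))
      adj (right x) rt        = trans (E-sym G (C₂.embed x) v) (adj rt (right x))
      adj (left x)  (left y)  = C₁.induced x y
      adj (right x) (right y) = C₂.induced x y
      adj (left x)  (right y) = no-edge x y
      adj (right x) (left y)  = trans (E-sym G (C₂.embed x) (C₁.embed y)) (no-edge y x)

  rooted-copy : ∀ i v k → HasIndex v k → 1 ≤ i → 2 * i ≤ k → Complete ch i v → RootedCopy i v
  rooted-copy (suc zero) v _ _ _ _ _ = single v
  rooted-copy (suc (suc zero)) v _ hv _ 4≤k cv with double-suc-≤ {1} 4≤k
  ... | K , refl , 2≤K = edge cv (grandchildren-on-both-sides v K hv 2≤K)
  rooted-copy (suc (suc (suc i))) v _ hv _ le cv with double-suc-≤ {suc (suc i)} le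
  ... | K , refl , le′ = glue 2≤K cv P (smaller p-grandchild p-colour) (smaller q-grandchild q-colour)
    where
      2≤K : 2 ≤ K
      2≤K = ≤-trans (s≤s (s≤s z≤n)) le′
      P = grandchildren-on-both-sides v K hv 2≤K
      open GrandchildPair P
      smaller : ∀ {g} → Grandchild ch v g → col g ≡ (a , K) → RootedCopy (suc (suc i)) g
      smaller gg cg = rooted-copy (suc (suc i)) _ K (inj₁ cg) (s≤s z≤n) le′ (complete-grandchild {suc (suc i)} gg cv)

claim7 : ∀ {n} (G : Graph n) (side : Fin n → Bool) → IsBipartition G side → P9Free G →
         (col : Fin n → Color) → Alg.AlgorithmColoring G side col →
         (ch : Fin n → Fin n) → Alg.GoodChoice G side col ch →
         (v : Fin n) (k i : ℕ) → Alg.HasIndex G side col v k → 1 ≤ i → 2 * i ≤ k →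
         Alg.Complete G side col ch i v → Alg.InducedCopyX G side col ch i v
claim7 G side bip _ col alg ch good v k i hv 1≤i 2i≤k complete =
  embed , injective , root , in-S , induced
  where
    open Construction G side bip col alg ch good using (rooted-copy; module RootedCopy)
    open RootedCopy (rooted-copy i v k hv 1≤i 2i≤k complete)
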